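{- Let $k>0$, $n,d\in\mathbb{N}$, and let $X\subseteq\mathbb{N}$ be a finite set which is $\omega^n\cdot R_k(2d)$-large and $(x\mapsto xk^x)$-sparse, with $k^{R_k(2d)}\leq\min X$. Let $f:[X]^2\to\{0,\dots,k-1\}$. Then there exist $(\omega^n+1)$-large subsets $Y_0<\dots<Y_{d-1}$ of $X$ and a color $c<k$ such that $f(x,y)=c$ for all $s<t<d$, $x\in Y_s$, $y\in Y_t$.
   Context: $R_k(d)$ is the least $R$ such that every $f:[\{0,\dots,R-1\}]^2\to k$ admits a homogeneous set of size $d$. For $g:\mathbb{N}\to\mathbb{N}$, a set $X$ is $g$-sparse if $y>g(x)$ for all $x<y$ in $X$. $X<Y$ means every element of $X$ is below every element of $Y$. Fundamental sequences: $\{0\}(x)=0$; for $\alpha\neq0$ write $\alpha=\delta+\omega^\gamma$ in Cantor normal form with $\omega^\gamma$ the last term; $\{\alpha\}(x)=\delta$ if $\gamma=0$, $\delta+\omega^{\gamma'}\cdot x$ if $\gamma=\gamma'+1$, $\delta+\omega^{\{\gamma\}(x)}$ if $\gamma$ is a limit. For finite $X=\{x_0<\dots<x_s\}$, $\{\alpha\}(X)=\{\cdots\{\{\alpha\}(x_0)\}(x_1)\cdots\}(x_s)$ and $X$ is $\alpha$-large iff $\{\alpha\}(X)=0$. -}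

module Defs where

open import Data.Nat using (ℕ; zero; suc; _+_; _*_; _^_; _≤_; _<_)
open import Data.Fin using (Fin)
open import Data.List using (List; []; _∷_; length)
open import Data.List.Membership.Propositional using (_∈_)
open import Data.List.Relation.Unary.Linked using (Linked)
open import Data.List.Relation.Unary.All using (All)
open import Data.Product using (Σ; ∃; _×_)
open import Function using (_∘_)
open import Relation.Binary.PropositionalEquality using (_≡_)

-- Ordinal terms below ε₀ in Cantor normal form, read from the last term:
-- `δ ⊕ω^ γ` denotes δ + ω^γ (ω^γ being the last CNF term).
data Ord : Set where
  𝟎     : Ord
  _⊕ω^_ : Ord → Ord → Ord

infixl 6 _⊕ω^_

nat : ℕ → Ord
nat zero    = 𝟎
nat (suc m) = nat m ⊕ω^ 𝟎

addωpow : Ord → Ord → ℕ → Ord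
addωpow δ γ zero    = δ
addωpow δ γ (suc x) = addωpow δ γ x ⊕ω^ γ

ωpow·_ : ℕ → ℕ → Ord
(ωpow· n) m = addωpow 𝟎 (nat n) m

ωpow+1 : ℕ → Ord
ωpow+1 n = 𝟎 ⊕ω^ nat n ⊕ω^ 𝟎

fund : Ord → ℕ → Ord
fund 𝟎 x = 𝟎
fund (δ ⊕ω^ 𝟎) x = δ
fund (δ ⊕ω^ (γ' ⊕ω^ 𝟎)) x = addωpow δ γ' x
fund (δ ⊕ω^ (γ₁ ⊕ω^ (a ⊕ω^ b))) x = δ ⊕ω^ fund (γ₁ ⊕ω^ (a ⊕ω^ b)) x

fundSet : Ord → List ℕ → Ord
fundSet α []       = α
fundSet α (x ∷ xs) = fundSet (fund α x) xs

-- finite sets of naturals are strictly increasing lists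
IncList : List ℕ → Set
IncList = Linked _<_

Large : Ord → List ℕ → Set
Large α X = fundSet α X ≡ 𝟎

Sparse : (ℕ → ℕ) → List ℕ → Set
Sparse g X = ∀ {x y} → x ∈ X → y ∈ X → x < y → g x < y

_⊆_ : List ℕ → List ℕ → Set
Y ⊆ X = ∀ {y} → y ∈ Y → y ∈ X

_≺_ : List ℕ → List ℕ → Set
X ≺ Y = ∀ {x y} → x ∈ X → y ∈ Y → x < y

Homogeneous : ∀ {k} → (ℕ → ℕ → Fin k) → List ℕ → Fin k → Set
Homogeneous f H c = ∀ {x y} → x ∈ H → y ∈ H → x < y → f x y ≡ c

RamseyProp : ℕ → ℕ → ℕ → Set
RamseyProp k d R =
  (f : ℕ → ℕ → Fin k) →
  Σ (List ℕ) λ H → IncList H × length H ≡ d × All (_< R) H ×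
    Σ (Fin k) λ c → Homogeneous f H c

IsRamseyNumber : ℕ → ℕ → ℕ → Set
IsRamseyNumber k d R = RamseyProp k d R × (∀ R' → RamseyProp k d R' → R ≤ R')

{-# OPTIONS --safe #-}
module Submission where

-- Cut X into R consecutive ω^n-blocks. Suppose that f is constant on B × B′ for any two blocks
-- B < B′, and that B ∪ B′ contains an (ω^n + 1)-large set. Colouring pairs of block indices by
-- that constant, R = R_k(2d) gives a homogeneous set of 2d indices, and pairing them up gives
-- the sets Y_s. For n = 0 (blocks are points) or k = 1 this applies to the blocks as they are,
-- with the set {min B} ∪ B′. Otherwise the blocks are thinned twice. First every block after the
-- first is shrunk so that f(x, ·) is constant on it for each earlier point x, by colouring its
-- points with their profiles (f(x, y))ₓ; then every block is shrunk so that its points share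
-- the profile (f(·, h))ₕ over the least points h of the blocks. Both steps are instances of a
-- pigeonhole principle for sums of ω^m-blocks, and the sparseness y > x·kˣ is what leaves
-- enough ω^(n-1)-blocks for the exponentially many colours: two points h < r of one block
-- followed by r of the ω^(n-1)-blocks of a later one form an (ω^n + 1)-large set.

open import Defs
open import Data.Nat using (ℕ; zero; suc; _+_; _*_; _^_; _≤_; _<_; z≤n; s≤s; _≤?_; NonZero; >-nonZero⁻¹)
open import Data.Nat.Properties
open import Data.Nat.Tactic.RingSolver using (solve-∀)
open import Data.Nat.DivMod using (_/_; m/n*n≤m; m≥n⇒m/n>0; m*n/n≡m; /-monoˡ-≤)
open import Data.Fin using (Fin; zero; suc; fromℕ<; combine) renaming (_<_ to _<ᶠ_)
import Data.Fin.Properties as Fin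
open import Data.List using (List; []; _∷_; _++_; length; filter; allFin; map)
open import Data.List.Properties using (++-assoc; ++-identityʳ; length-++; length-tabulate; length-map)
open import Data.List.Extrema.Nat using (max; ⊥≤max; xs≤max; argmax-sel)
open import Data.List.Membership.Propositional using (_∈_)
open import Data.List.Membership.Propositional.Properties
  using (∈-++⁺ˡ; ∈-++⁺ʳ; ∈-++⁻; ∈-filter⁻; ∈-allFin; ∈-map⁺)
open import Data.List.Relation.Unary.Any using (Any; here; there)
open import Data.List.Relation.Unary.All as All using (All; []; _∷_)
import Data.List.Relation.Unary.All.Properties as All
import Data.List.Relation.Unary.Any.Properties as Any
open import Data.List.Relation.Unary.AllPairs using (AllPairs; []; _∷_)
import Data.List.Relation.Unary.AllPairs.Properties as AllPairs
open import Data.List.Relation.Unary.Linked.Properties using (AllPairs⇒Linked; Linked⇒AllPairs)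
import Data.List.Relation.Binary.Sublist.Propositional.Properties as Sublist
open import Data.Product using (Σ; _×_; _,_; proj₁; proj₂)
open import Data.Sum using (inj₁; inj₂; [_,_]′)
open import Relation.Binary.PropositionalEquality
open import Function using (id; _∘_)
open import Relation.Nullary using (yes; no; ¬?; Dec; contradiction)

Increasing : List ℕ → Set
Increasing = AllPairs _<_

AllPairs-++⁻ : ∀ {A : Set} {R : A → A → Set} xs {ys} → AllPairs R (xs ++ ys) →
               AllPairs R xs × AllPairs R ys × (∀ {x y} → x ∈ xs → y ∈ ys → R x y)
AllPairs-++⁻ []       Rys               = [] , Rys , λ ()
AllPairs-++⁻ (x ∷ xs) (Rxxsys ∷ Rxsys) with AllPairs-++⁻ xs Rxsys
... | Rxs , Rys , cross = All.++⁻ˡ xs Rxxsys ∷ Rxs , Rys , λ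
  { (here refl) y∈ → All.lookup (All.++⁻ʳ xs Rxxsys) y∈
  ; (there x∈)  y∈ → cross x∈ y∈ }

Increasing-++⁺ : ∀ {xs ys} → Increasing xs → Increasing ys → xs ≺ ys → Increasing (xs ++ ys)
Increasing-++⁺ incxs incys xs≺ys =
  AllPairs.++⁺ incxs incys (All.tabulate λ x∈ → All.tabulate λ y∈ → xs≺ys x∈ y∈)

AllPairs-mapWithAll : ∀ {A : Set} {P : A → Set} {R S : A → A → Set} {xs} →
                      (∀ {x y} → P x → P y → R x y → S x y) → All P xs → AllPairs R xs → AllPairs S xs
AllPairs-mapWithAll g []         []         = []
AllPairs-mapWithAll g (px ∷ pxs) (Rx ∷ Rxs) =
  All.zipWith (λ (py , r) → g px py r) (pxs , Rx) ∷ AllPairs-mapWithAll g pxs Rxs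

Sparse-⊆ : ∀ {g Y X} → Y ⊆ X → Sparse g X → Sparse g Y
Sparse-⊆ Y⊆X sparse x∈ y∈ = sparse (Y⊆X x∈) (Y⊆X y∈)

prefix-⊆ : ∀ {C P Q} → C ≡ P ++ Q → P ⊆ C
prefix-⊆ refl = ∈-++⁺ˡ

prefix-increasing : ∀ {C P Q} → C ≡ P ++ Q → Increasing C → Increasing P
prefix-increasing {P = P} refl inc = proj₁ (AllPairs-++⁻ P inc)

hd : List ℕ → ℕ
hd []      = 0
hd (x ∷ _) = x

hd-∈ : ∀ {xs} → 0 < length xs → hd xs ∈ xs
hd-∈ {_ ∷ _} _ = here refl

∈⇒hd-∈ : ∀ {x xs} → x ∈ xs → hd xs ∈ xs
∈⇒hd-∈ {xs = _ ∷ _} _ = here refl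

max-∈ : ∀ x xs → max x xs ∈ x ∷ xs
max-∈ x xs = [ (λ eq → subst (_∈ x ∷ xs) (sym eq) (here refl)) , there ]′ (argmax-sel id x xs)

-- Pigeonhole

module _ {A : Set} {K : ℕ} (c : A → Fin K) where

  ofColour : Fin K → List A → List A
  ofColour a = filter (λ x → c x Fin.≟ a)

  private
    others : Fin K → List A → List A
    others a = filter (λ x → ¬? (c x Fin.≟ a))

    length-split : ∀ a xs → length xs ≡ length (ofColour a xs) + length (others a xs)
    length-split a []       = refl
    length-split a (x ∷ xs) with c x Fin.≟ a
    ... | yes _ = cong suc (length-split a xs)
    ... | no  _ = trans (cong suc (length-split a xs)) (sym (+-suc _ _))

    ofColour-others : ∀ a b xs → length (ofColour b (others a xs)) ≤ length (ofColour b xs)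
    ofColour-others a b xs = Sublist.length-mono-≤ (Sublist.filter⁺ _ _ (λ { refl p → p }) (Sublist.filter-⊆ _ xs))

    pigeonhole-⊆ : ∀ (cs : List (Fin K)) xs → (∀ {x} → x ∈ xs → c x ∈ cs) → Fin K →
                   Σ (Fin K) λ a → length xs ≤ length cs * length (ofColour a xs)
    pigeonhole-⊆ []       []      _     a₀ = a₀ , z≤n
    pigeonhole-⊆ []       (x ∷ _) cover _  with () ← cover (here refl)
    pigeonhole-⊆ (a ∷ cs) xs      cover a₀ with length xs ≤? suc (length cs) * length (ofColour a xs)
    ... | yes many = a , many
    ... | no  few  with pigeonhole-⊆ cs (others a xs) cover′ a₀
      where
      cover′ : ∀ {x} → x ∈ others a xs → c x ∈ cs
      cover′ x∈ with ∈-filter⁻ (λ x → ¬? (c x Fin.≟ a)) {xs = xs} x∈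
      ... | x∈xs , cx≢a with cover x∈xs
      ...   | here cx≡a = contradiction cx≡a cx≢a
      ...   | there cx∈ = cx∈
    ...   | b , bound = b , ≤-case (length (ofColour b (others a xs)) ≤? length (ofColour a xs))
      where
      open ≤-Reasoning
      L = length cs
      nᵃ = length (ofColour a xs)
      nᵇ = length (ofColour b xs)
      nᵇ′ = length (ofColour b (others a xs))
      ≤-case : Dec (nᵇ′ ≤ nᵃ) → length xs ≤ suc L * nᵇ
      ≤-case (yes nᵇ′≤nᵃ) = contradiction (begin
        length xs                      ≡⟨ length-split a xs ⟩
        nᵃ + length (others a xs)      ≤⟨ +-monoʳ-≤ nᵃ (≤-trans bound (*-monoʳ-≤ L nᵇ′≤nᵃ)) ⟩
        suc L * nᵃ                     ∎) few
      ≤-case (no nᵇ′≰nᵃ) = begin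
        length xs                      ≡⟨ length-split a xs ⟩
        nᵃ + length (others a xs)      ≤⟨ +-mono-≤ (<⇒≤ (≰⇒> nᵇ′≰nᵃ)) bound ⟩
        suc L * nᵇ′                    ≤⟨ *-monoʳ-≤ (suc L) (ofColour-others a b xs) ⟩
        suc L * nᵇ                     ∎

  pigeonhole : .{{NonZero K}} → ∀ xs → Σ (Fin K) λ a → length xs ≤ K * length (ofColour a xs)
  pigeonhole xs with pigeonhole-⊆ (allFin K) xs (λ _ → ∈-allFin _) (fromℕ< (>-nonZero⁻¹ K))
  ... | a , bound = a , subst (λ n → length xs ≤ n * length (ofColour a xs)) (length-tabulate {n = K} id) bound

-- Blocks

-- An ω^(m+1)-block is its least element x followed by x consecutive ω^m-blocks, because
-- {ω^(m+1)}(x) = ω^m · x; an ω^0-block is a single point.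
mutual
  data Block : ℕ → List ℕ → Set where
    leaf : ∀ x → Block 0 (x ∷ [])
    node : ∀ {m x P} → Blocks m x P → Block (suc m) (x ∷ P)

  data Blocks (m : ℕ) : ℕ → List ℕ → Set where
    []  : Blocks m 0 []
    _∷_ : ∀ {j T P} → Block m T → Blocks m j P → Blocks m (suc j) (T ++ P)

mutual
  fundSet-Block : ∀ {m P} → Block m P → ∀ δ Q → fundSet (δ ⊕ω^ nat m) (P ++ Q) ≡ fundSet δ Q
  fundSet-Block (leaf x)  δ Q = refl
  fundSet-Block (node Ps) δ Q = fundSet-Blocks Ps δ Q

  fundSet-Blocks : ∀ {m j P} → Blocks m j P → ∀ δ Q →
                   fundSet (addωpow δ (nat m) j) (P ++ Q) ≡ fundSet δ Q
  fundSet-Blocks []                         δ Q = refl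
  fundSet-Blocks {m} (_∷_ {j} {T} {P} B Ps) δ Q = begin
    fundSet (addωpow δ (nat m) j ⊕ω^ nat m) ((T ++ P) ++ Q) ≡⟨ cong (fundSet _) (++-assoc T P Q) ⟩
    fundSet (addωpow δ (nat m) j ⊕ω^ nat m) (T ++ P ++ Q)   ≡⟨ fundSet-Block B _ (P ++ Q) ⟩
    fundSet (addωpow δ (nat m) j) (P ++ Q)                  ≡⟨ fundSet-Blocks Ps δ Q ⟩
    fundSet δ Q                                             ∎
    where open ≡-Reasoning

mutual
  Block-prefix : ∀ m δ X → fundSet (δ ⊕ω^ nat m) X ≡ 𝟎 →
                 Σ (List ℕ) λ P → Σ (List ℕ) λ Q → X ≡ P ++ Q × Block m P × fundSet δ Q ≡ 𝟎
  Block-prefix m       δ []      ()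
  Block-prefix zero    δ (x ∷ X) large = x ∷ [] , X , refl , leaf x , large
  Block-prefix (suc m) δ (x ∷ X) large with Blocks-prefix m x δ X large
  ... | P , Q , refl , Ps , large′ = x ∷ P , Q , refl , node Ps , large′

  Blocks-prefix : ∀ m j δ X → fundSet (addωpow δ (nat m) j) X ≡ 𝟎 →
                  Σ (List ℕ) λ P → Σ (List ℕ) λ Q → X ≡ P ++ Q × Blocks m j P × fundSet δ Q ≡ 𝟎
  Blocks-prefix m zero    δ X large = [] , X , refl , [] , large
  Blocks-prefix m (suc j) δ X large with Block-prefix m (addωpow δ (nat m) j) X large
  ... | T , X′ , refl , B , large′ with Blocks-prefix m j δ X′ large′
  ...   | P , Q , refl , Ps , large″ = T ++ P , Q , sym (++-assoc T P Q) , B ∷ Ps , large″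

Large-ωpow+1 : ∀ {n Z} h → Block n Z → Large (ωpow+1 n) (h ∷ Z)
Large-ωpow+1 {n} {Z} h B =
  trans (cong (fundSet (𝟎 ⊕ω^ nat n)) (sym (++-identityʳ Z))) (fundSet-Block B 𝟎 [])

Blocks-take : ∀ {m j C} → Blocks m j C → ∀ {i} → i ≤ j →
              Σ (List ℕ) λ P → Σ (List ℕ) λ Q → C ≡ P ++ Q × Blocks m i P
Blocks-take {C = C} Ps        {zero}  _         = [] , C , refl , []
Blocks-take (_∷_ {T = T} B Ps) {suc i} (s≤s i≤j) with Blocks-take Ps i≤j
... | P , Q , refl , Ps′ = T ++ P , Q , sym (++-assoc T P Q) , B ∷ Ps′

Block-nonempty : ∀ {m T} → Block m T → 0 < length T
Block-nonempty (leaf _) = s≤s z≤n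
Block-nonempty (node _) = s≤s z≤n

Blocks-length : ∀ {m j C} → Blocks m j C → j ≤ length C
Blocks-length []                    = z≤n
Blocks-length (_∷_ {T = T} {P} B Ps) =
  subst (_ ≤_) (sym (length-++ T)) (+-mono-≤ (Block-nonempty B) (Blocks-length Ps))

Block-after-pair : ∀ {m b₁ b₂ B C w} → Increasing (b₁ ∷ b₂ ∷ B) → Blocks m w C → Increasing C →
  b₂ ≤ w → (b₁ ∷ b₂ ∷ B) ≺ C →
  Σ (List ℕ) λ Y → Increasing Y × Large (ωpow+1 (suc m)) Y × Y ⊆ ((b₁ ∷ b₂ ∷ B) ++ C)
Block-after-pair {b₁ = b₁} {b₂} {B} ((b₁<b₂ ∷ _) ∷ _) BsC incC b₂≤w B≺C with Blocks-take BsC b₂≤w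
... | P , _ , C≡P++ , BsP = b₁ ∷ b₂ ∷ P , incY , Large-ωpow+1 b₁ (node BsP) , Y⊆
  where
  P⊆C = prefix-⊆ C≡P++
  incY : Increasing (b₁ ∷ b₂ ∷ P)
  incY = (b₁<b₂ ∷ All.tabulate (B≺C (here refl) ∘ P⊆C)) ∷ All.tabulate (B≺C (there (here refl)) ∘ P⊆C) ∷
         prefix-increasing C≡P++ incC
  Y⊆ : (b₁ ∷ b₂ ∷ P) ⊆ ((b₁ ∷ b₂ ∷ B) ++ _)
  Y⊆ (here refl)         = here refl
  Y⊆ (there (here refl)) = there (here refl)
  Y⊆ (there (there y∈))  = ∈-++⁺ʳ (b₁ ∷ b₂ ∷ B) (P⊆C y∈)

Blocks-singletons : ∀ xs → Blocks 0 (length xs) xs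
Blocks-singletons []       = []
Blocks-singletons (x ∷ xs) = leaf x ∷ Blocks-singletons xs

Blocks-components : ∀ {m j P} → Blocks m j P → Increasing P →
  Σ (List (List ℕ)) λ Zs → length Zs ≡ j × All (λ Z → Block m Z × Z ⊆ P × Increasing Z) Zs × AllPairs _≺_ Zs
Blocks-components []                    _   = [] , refl , [] , []
Blocks-components (_∷_ {T = T} {P} B Ps) inc with AllPairs-++⁻ T inc
... | incT , incP , T≺P with Blocks-components Ps incP
...   | Zs , len , pieces , ordered =
  T ∷ Zs , cong suc len , (B , ∈-++⁺ˡ , incT) ∷ All.map shift pieces , All.map after pieces ∷ ordered
  where
  shift : ∀ {Z} → Block _ Z × Z ⊆ P × Increasing Z → Block _ Z × Z ⊆ (T ++ P) × Increasing Z
  shift (BZ , Z⊆ , incZ) = BZ , ∈-++⁺ʳ T ∘ Z⊆ , incZ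
  after : ∀ {Z} → Block _ Z × Z ⊆ P × Increasing Z → T ≺ Z
  after (_ , Z⊆ , _) x∈ y∈ = T≺P x∈ (Z⊆ y∈)

2[1+q]≤2+n⇒2q≤n : ∀ {q n} → 2 * suc q ≤ suc (suc n) → 2 * q ≤ n
2[1+q]≤2+n⇒2q≤n {q} {n} le = ≤-pred (≤-pred (subst (_≤ suc (suc n)) (*-suc 2 q) le))

-- A pigeonhole principle for sums of blocks

module _ {K : ℕ} .{{_ : NonZero K}} (c : ℕ → Fin K) where

  private
    D : ℕ
    D = 2 * K

    instance
      D-nonZero : NonZero D
      D-nonZero = m*n≢0 2 K

    m*D≤n⇒m≤n/D : ∀ {m n} → m * D ≤ n → m ≤ n / D
    m*D≤n⇒m≤n/D {m} le = subst (_≤ _) (m*n/n≡m m D) (/-monoˡ-≤ D le)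

    q*D≤N≤K*F⇒2q≤F : ∀ {q N F} → q * D ≤ N → N ≤ K * F → 2 * q ≤ F
    q*D≤N≤K*F⇒2q≤F {q} {N} {F} qD≤N N≤KF =
      *-cancelˡ-≤ K (subst (_≤ K * F) (swap q K) (≤-trans qD≤N N≤KF))
      where
      swap : ∀ q K → q * (2 * K) ≡ K * (2 * q)
      swap = solve-∀

  PartitionProperty : ℕ → Set
  PartitionProperty m = ∀ q {N L} → Blocks m N L → Increasing L → Sparse (_* (2 * K)) L →
    All (2 * K ≤_) L → q * (2 * K) ≤ N →
    Σ (List ℕ) λ S → S ⊆ L × Increasing S × Blocks m q S × Σ (Fin K) λ a → All (λ x → c x ≡ a) S

  partition-base : PartitionProperty 0
  partition-base q {L = L} Ps inc sparse big qD≤N with pigeonhole c L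
  ... | a , L≤KF with Blocks-take (Blocks-singletons (ofColour c a L))
                        (≤-trans (m≤m+n q (q + 0))
                                 (q*D≤N≤K*F⇒2q≤F {q} qD≤N (≤-trans (Blocks-length Ps) L≤KF)))
  ...   | S , _ , F≡S++ , BsS =
    S , (λ x∈ → proj₁ (∈-filter⁻ P? {xs = L} (S⊆F x∈))) ,
    prefix-increasing F≡S++ (AllPairs.filter⁺ P? {xs = L} inc) ,
    BsS , a , All.tabulate (λ x∈ → proj₂ (∈-filter⁻ P? {xs = L} (S⊆F x∈)))
    where
    P? = λ x → c x Fin.≟ a
    S⊆F = prefix-⊆ F≡S++

  -- Each ω^(m+1)-block r ∷ body contains, by induction, a monochromatic piece made of r / D
  -- ω^m-blocks. Of the N pieces 2q share a colour, and two consecutive ones p₁, p₂ give an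
  -- ω^(m+1)-block: the least point x of p₁ followed by x ω^m-blocks of p₂, of which there are
  -- enough because x · D < head p₂ by sparseness.
  module PartitionStep (m : ℕ) (ih : PartitionProperty m) where

    record Piece : Set where
      field
        head       : ℕ
        colour     : Fin K
        elems      : List ℕ
        blocks     : Blocks m (head / D) elems
        increasing : Increasing elems
        mono       : All (λ x → c x ≡ colour) elems
        D≤head     : D ≤ head
    open Piece

    first∈ : ∀ p → hd (elems p) ∈ elems p
    first∈ p = hd-∈ (≤-trans (m≥n⇒m/n>0 (D≤head p)) (Blocks-length (blocks p)))

    Precedes : Piece → Piece → Set
    Precedes p p′ = elems p ≺ elems p′ × All (_≤ head p′ / D) (elems p)

    pieces : ∀ {N L} → Blocks (suc m) N L → Increasing L → Sparse (_* D) L → All (D ≤_) L →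
             Σ (List Piece) λ ps → length ps ≡ N × AllPairs Precedes ps ×
               All (λ p → head p ∈ L × elems p ⊆ L) ps
    pieces [] _ _ _ = [] , refl , [] , []
    pieces {L = L} (_∷_ {P = rest} (node {x = r} {P = body} Bs) Ps) inc sparse big
      with AllPairs-++⁻ (r ∷ body) inc | All.++⁻ (r ∷ body) big
    ... | _ ∷ inc-body , inc-rest , cross | D≤r ∷ big-body , big-rest
      with ih (r / D) Bs inc-body (Sparse-⊆ (there ∘ ∈-++⁺ˡ) sparse) big-body (m/n*n≤m r D)
    ... | S , S⊆body , incS , BsS , a , monoS
      with pieces Ps inc-rest (Sparse-⊆ (∈-++⁺ʳ (r ∷ body)) sparse) big-rest
    ... | ps , len , prec , inv =
      p ∷ ps , cong suc len , All.map (λ {p′} → precedes {p′}) inv ∷ prec ,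
      (here refl , λ x∈ → there (∈-++⁺ˡ (S⊆body x∈))) ∷ All.map (λ {p′} → lift {p′}) inv
      where
      p : Piece
      p = record { head = r ; colour = a ; elems = S ; blocks = BsS ; increasing = incS ; mono = monoS ; D≤head = D≤r }
      lift : ∀ {p′} → head p′ ∈ rest × elems p′ ⊆ rest → head p′ ∈ L × elems p′ ⊆ L
      lift (h∈ , sub) = ∈-++⁺ʳ (r ∷ body) h∈ , ∈-++⁺ʳ (r ∷ body) ∘ sub
      precedes : ∀ {p′} → head p′ ∈ rest × elems p′ ⊆ rest → Precedes p p′
      precedes (h∈ , sub) = (λ x∈ y∈ → cross (there (S⊆body x∈)) (sub y∈)) , All.tabulate λ {x} x∈ →
        m*D≤n⇒m≤n/D {x} (<⇒≤ (sparse (there (∈-++⁺ˡ (S⊆body x∈))) (∈-++⁺ʳ (r ∷ body) h∈)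
                                     (cross (there (S⊆body x∈)) h∈)))

    pairPieces : ∀ a q (ps : List Piece) → 2 * q ≤ length ps → AllPairs Precedes ps →
             All (λ p → colour p ≡ a) ps →
             Σ (List ℕ) λ S → Blocks (suc m) q S × Increasing S × All (λ x → c x ≡ a) S ×
               (∀ {y} → y ∈ S → Any (λ p → y ∈ elems p) ps)
    pairPieces a zero    ps       _  _ _ = [] , [] , [] , [] , λ ()
    pairPieces a (suc q) []       () _ _
    pairPieces a (suc q) (_ ∷ []) le _ _ with () ← ≤-pred (subst (_≤ 1) (*-suc 2 q) le)
    pairPieces a (suc q) (p₁ ∷ p₂ ∷ ps) le ((p₁≺p₂ ∷ p₁≺ps) ∷ p₂≺ps ∷ prec) (a₁ ∷ a₂ ∷ as)
      with Blocks-take (blocks p₂) (All.lookup (proj₂ p₁≺p₂) (first∈ p₁))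
    ... | P , _ , p₂≡P++ , BsP with pairPieces a q ps (2[1+q]≤2+n⇒2q≤n le) prec as
    ...   | S , BsS , incS , monoS , prov =
      (x ∷ P) ++ S , node BsP ∷ BsS , Increasing-++⁺ incxP incS xP≺S ,
      All.++⁺ (trans (All.lookup (mono p₁) x∈) a₁ ∷
               All.tabulate (λ y∈ → trans (All.lookup (mono p₂) (P⊆ y∈)) a₂)) monoS ,
      prov′
      where
      x = hd (elems p₁)
      x∈ : x ∈ elems p₁
      x∈ = first∈ p₁
      P⊆ : P ⊆ elems p₂
      P⊆ = prefix-⊆ p₂≡P++
      incxP : Increasing (x ∷ P)
      incxP = All.tabulate (λ y∈ → proj₁ p₁≺p₂ x∈ (P⊆ y∈)) ∷ prefix-increasing p₂≡P++ (increasing p₂)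
      xP≺S : (x ∷ P) ≺ S
      xP≺S (here refl) y∈ =
        All.lookupWith {R = λ _ → x < _} (λ p₁≺p y∈p → proj₁ p₁≺p x∈ y∈p) p₁≺ps (prov y∈)
      xP≺S (there u∈)  y∈ =
        All.lookupWith {R = λ _ → _ < _} (λ p₂≺p y∈p → proj₁ p₂≺p (P⊆ u∈) y∈p) p₂≺ps (prov y∈)
      prov′ : ∀ {y} → y ∈ (x ∷ P) ++ S → Any (λ p → y ∈ elems p) (p₁ ∷ p₂ ∷ ps)
      prov′ y∈ with ∈-++⁻ (x ∷ P) y∈
      ... | inj₁ (here refl) = here x∈
      ... | inj₁ (there y∈P) = there (here (P⊆ y∈P))
      ... | inj₂ y∈S         = there (there (prov y∈S))

    step : PartitionProperty (suc m)
    step q Ps inc sparse big qD≤N with pieces Ps inc sparse big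
    ... | ps , refl , prec , inv with pigeonhole colour ps
    ... | a , ps≤KF with pairPieces a q (ofColour colour a ps) (q*D≤N≤K*F⇒2q≤F {q} qD≤N ps≤KF)
                           (AllPairs.filter⁺ P? prec) (All.tabulate λ p∈ → proj₂ (∈-filter⁻ P? {xs = ps} p∈))
      where P? = λ p → colour p Fin.≟ a
    ... | S , BsS , incS , monoS , prov =
      S , (λ y∈ → All.lookupWith {R = λ _ → _ ∈ _} (λ inv y∈p → proj₂ inv y∈p) inv
                                  (Any.filter⁻ _ (prov y∈))) ,
      incS , BsS , a , monoS

  partition : ∀ m → PartitionProperty m
  partition zero    = partition-base
  partition (suc m) = PartitionStep.step m (partition m)

-- Good pairs of blocks and Ramsey's theorem

HomogeneousFamily : ∀ {k} → (ℕ → ℕ → Fin k) → ℕ → List ℕ → ℕ → Set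
HomogeneousFamily {k} f n X d = Σ (Fin d → List ℕ) λ Y → Σ (Fin k) λ c →
  (∀ s → IncList (Y s) × Y s ⊆ X × Large (ωpow+1 n) (Y s)) ×
  (∀ s t → s <ᶠ t → (Y s ≺ Y t) × (∀ {x y} → x ∈ Y s → y ∈ Y t → f x y ≡ c))

nth : ∀ {A : Set} → A → List A → ℕ → A
nth a₀ []       _       = a₀
nth a₀ (a ∷ as) zero    = a
nth a₀ (a ∷ as) (suc i) = nth a₀ as i

nth-∈ : ∀ {A : Set} {a₀ : A} as {i} → i < length as → nth a₀ as i ∈ as
nth-∈ (a ∷ as) {zero}  _         = here refl
nth-∈ (a ∷ as) {suc i} (s≤s i<n) = there (nth-∈ as i<n)

AllPairs-nth : ∀ {A : Set} {R : A → A → Set} {a₀ : A} {as} → AllPairs R as →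
               ∀ {i j} → i < j → j < length as → R (nth a₀ as i) (nth a₀ as j)
AllPairs-nth {as = a ∷ as} (Ra ∷ _)  {zero}  {suc j} _         (s≤s j<n) = All.lookup Ra (nth-∈ as j<n)
AllPairs-nth {as = a ∷ as} (_ ∷ Ras) {suc i} {suc j} (s≤s i<j) (s≤s j<n) = AllPairs-nth Ras i<j j<n

module _ {k} (f : ℕ → ℕ → Fin k) (n : ℕ) (X : List ℕ) where

  GoodPair : List ℕ → List ℕ → Set
  GoodPair B B′ = B ≺ B′ × (∀ {x y} → x ∈ B → y ∈ B′ → f x y ≡ f (hd B) (hd B′)) ×
    Σ (List ℕ) λ Y → Increasing Y × Y ⊆ X × Large (ωpow+1 n) Y × Y ⊆ (B ++ B′)

  module _ {R} (Bs : List (List ℕ)) (len : length Bs ≡ R) (good : AllPairs GoodPair Bs) where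

    private
      B : ℕ → List ℕ
      B = nth [] Bs

      good-at : ∀ {i j} → i < j → j < R → GoodPair (B i) (B j)
      good-at i<j j<R = AllPairs-nth good i<j (subst (_ <_) (sym len) j<R)

      CrossColoured : List ℕ → Fin k → Set
      CrossColoured H c = ∀ {i j x y} → i ∈ H → j ∈ H → i < j → x ∈ B i → y ∈ B j → x < y × f x y ≡ c

      pairBlocks : ∀ {c} d H → length H ≡ 2 * d → Increasing H → All (_< R) H → CrossColoured H c →
        Σ (Fin d → List ℕ) λ Y → (∀ s → Increasing (Y s) × Y s ⊆ X × Large (ωpow+1 n) (Y s)) ×
          (∀ s {y} → y ∈ Y s → Σ ℕ λ i → i ∈ H × y ∈ B i) ×
          (∀ s t → s <ᶠ t → (Y s ≺ Y t) × (∀ {x y} → x ∈ Y s → y ∈ Y t → f x y ≡ c))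
      pairBlocks zero    _       _   _ _ _ = (λ ()) , (λ ()) , (λ ()) , λ ()
      pairBlocks (suc d) []      ()  _ _ _
      pairBlocks (suc d) (_ ∷ []) len _ _ _ with () ← trans (suc-injective len) (+-suc d (d + 0))
      pairBlocks {c} (suc d) (a ∷ b ∷ H) len ((a<b ∷ a<H) ∷ b<H ∷ incH) (_ ∷ b<R ∷ H<R) cross
        with good-at a<b b<R
      ... | _ , _ , Y₀ , incY₀ , Y₀⊆X , largeY₀ , Y₀⊆ab
        with pairBlocks d H (suc-injective (trans (suc-injective len) (+-suc d (d + 0)))) incH H<R
               (λ i∈ j∈ → cross (there (there i∈)) (there (there j∈)))
      ... | Y , props , origin , crossY = Y′ , props′ , origin′ , crossY′
        where
        Y′ : Fin (suc d) → List ℕ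
        Y′ zero    = Y₀
        Y′ (suc s) = Y s
        props′ : ∀ s → Increasing (Y′ s) × Y′ s ⊆ X × Large (ωpow+1 n) (Y′ s)
        props′ zero    = incY₀ , Y₀⊆X , largeY₀
        props′ (suc s) = props s
        origin′ : ∀ s {y} → y ∈ Y′ s → Σ ℕ λ i → i ∈ a ∷ b ∷ H × y ∈ B i
        origin′ zero y∈ with ∈-++⁻ (B a) (Y₀⊆ab y∈)
        ... | inj₁ y∈a = a , here refl , y∈a
        ... | inj₂ y∈b = b , there (here refl) , y∈b
        origin′ (suc s) y∈ with origin s y∈
        ... | i , i∈ , y∈i = i , there (there i∈) , y∈i
        cross₀ : ∀ t {x y} → x ∈ Y₀ → y ∈ Y t → x < y × f x y ≡ c
        cross₀ t x∈ y∈ with origin t y∈ | ∈-++⁻ (B a) (Y₀⊆ab x∈)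
        ... | j , j∈ , y∈j | inj₁ x∈a = cross (here refl) (there (there j∈)) (All.lookup a<H j∈) x∈a y∈j
        ... | j , j∈ , y∈j | inj₂ x∈b = cross (there (here refl)) (there (there j∈)) (All.lookup b<H j∈) x∈b y∈j
        crossY′ : ∀ s t → s <ᶠ t → (Y′ s ≺ Y′ t) × (∀ {x y} → x ∈ Y′ s → y ∈ Y′ t → f x y ≡ c)
        crossY′ zero    (suc t) _         =
          (λ x∈ y∈ → proj₁ (cross₀ t x∈ y∈)) , λ x∈ y∈ → proj₂ (cross₀ t x∈ y∈)
        crossY′ (suc s) (suc t) (s≤s s<t) = crossY s t s<t

    GoodPairs⇒HomogeneousFamily : ∀ {d} → RamseyProp k (2 * d) R → HomogeneousFamily f n X d
    GoodPairs⇒HomogeneousFamily {d} ramsey with ramsey (λ i j → f (hd (B i)) (hd (B j)))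
    ... | H , linked , lenH , H<R , c , homogeneous
      with pairBlocks d H lenH (Linked⇒AllPairs <-trans linked) H<R cross
      where
      cross : CrossColoured H c
      cross i∈ j∈ i<j x∈ y∈ with good-at i<j (All.lookup H<R j∈)
      ... | ≺ , constant , _ = ≺ x∈ y∈ , trans (constant x∈ y∈) (homogeneous i∈ j∈ i<j)
    ... | Y , props , _ , crossY = Y , c , (λ s → AllPairs⇒Linked (proj₁ (props s)) , proj₂ (props s)) , crossY

  blockwiseConstant⇒HomogeneousFamily : ∀ {d R P} → Blocks n R P → P ⊆ X → Increasing P →
    (∀ {Z Z′ x y} → Block n Z → Block n Z′ → x ∈ Z → y ∈ Z′ → f x y ≡ f (hd Z) (hd Z′)) →
    RamseyProp k (2 * d) R → HomogeneousFamily f n X d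
  blockwiseConstant⇒HomogeneousFamily Ps P⊆X incP constant ramsey with Blocks-components Ps incP
  ... | Zs , len , pieces , ordered =
    GoodPairs⇒HomogeneousFamily Zs len (AllPairs-mapWithAll good pieces ordered) ramsey
    where
    good : ∀ {Z Z′} → Block n Z × Z ⊆ _ × Increasing Z → Block n Z′ × Z′ ⊆ _ × Increasing Z′ →
           Z ≺ Z′ → GoodPair Z Z′
    good {Z} {Z′} (BZ , Z⊆ , _) (BZ′ , Z′⊆ , incZ′) Z≺Z′ =
      Z≺Z′ , constant BZ BZ′ ,
      hd Z ∷ Z′ , All.tabulate (Z≺Z′ h∈) ∷ incZ′ , Y⊆X , Large-ωpow+1 (hd Z) BZ′ , Y⊆
      where
      h∈ : hd Z ∈ Z
      h∈ = hd-∈ (Block-nonempty BZ)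
      Y⊆X : (hd Z ∷ Z′) ⊆ X
      Y⊆X (here refl) = P⊆X (Z⊆ h∈)
      Y⊆X (there y∈)  = P⊆X (Z′⊆ y∈)
      Y⊆ : (hd Z ∷ Z′) ⊆ (Z ++ Z′)
      Y⊆ (here refl) = ∈-++⁺ˡ h∈
      Y⊆ (there y∈)  = ∈-++⁺ʳ Z y∈

-- Thinning the blocks

encode : ∀ {k} (W : List ℕ) → (ℕ → Fin k) → Fin (k ^ length W)
encode []      h = zero
encode (w ∷ W) h = combine (h w) (encode W h)

encode-injective : ∀ {k} W {h h′ : ℕ → Fin k} → encode W h ≡ encode W h′ →
                   ∀ {x} → x ∈ W → h x ≡ h′ x
encode-injective (w ∷ W) {h} {h′} eq x∈ with Fin.combine-injective (h w) (encode W h) (h′ w) (encode W h′) eq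
encode-injective (w ∷ W) eq (here refl) | hw≡ , _ = hw≡
encode-injective (w ∷ W) eq (there x∈)  | _ , rest≡ = encode-injective W rest≡ x∈

increasing-spread : ∀ {y ys w} → Increasing (y ∷ ys) → All (_≤ w) (y ∷ ys) → y + length ys ≤ w
increasing-spread {y} {[]}     _                   (y≤w ∷ _)  = subst (_≤ _) (sym (+-identityʳ y)) y≤w
increasing-spread {y} {_ ∷ ys} {w} ((y<y′ ∷ _) ∷ inc) (_ ∷ ≤w) =
  subst (_≤ w) (sym (+-suc y (length ys))) (≤-trans (+-monoˡ-≤ (length ys) y<y′) (increasing-spread inc ≤w))

m<n≤m*o⇒2≤o : ∀ {m n o} → m < n → n ≤ m * o → 2 ≤ o
m<n≤m*o⇒2≤o {m} {n} {zero}        m<n n≤ =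
  contradiction (≤-trans m<n (subst (n ≤_) (*-zeroʳ m) n≤)) λ ()
m<n≤m*o⇒2≤o {m} {n} {suc zero}    m<n n≤ =
  contradiction (≤-trans m<n (subst (n ≤_) (*-identityʳ m) n≤)) (<-irrefl refl)
m<n≤m*o⇒2≤o         {o = suc (suc o)} _   _  = s≤s (s≤s z≤n)

n≤m*n : ∀ {m} n → 1 ≤ m → n ≤ m * n
n≤m*n {m} n 1≤m = subst (_≤ m * n) (*-identityˡ n) (*-monoˡ-≤ n 1≤m)

module _ (k : ℕ) .{{_ : NonZero k}} (1<k : 1 < k) where

  n<k^n : ∀ n → n < k ^ n
  n<k^n zero    = s≤s z≤n
  n<k^n (suc n) = begin-strict
    suc n       <⟨ s≤s (n<k^n n) ⟩
    1 + k ^ n   ≤⟨ +-monoˡ-≤ (k ^ n) (m^n>0 k n) ⟩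
    k ^ n + k ^ n ≡⟨ cong (k ^ n +_) (sym (+-identityʳ (k ^ n))) ⟩
    2 * k ^ n   ≤⟨ *-monoˡ-≤ (k ^ n) 1<k ⟩
    k * k ^ n   ∎
    where open ≤-Reasoning

  [2*k^a]*[2*k^b]≤k^[2+a+b] : ∀ a b → (2 * k ^ a) * (2 * k ^ b) ≤ k ^ (2 + a + b)
  [2*k^a]*[2*k^b]≤k^[2+a+b] a b = begin
    (2 * k ^ a) * (2 * k ^ b) ≡⟨ regroup 2 (k ^ a) (k ^ b) ⟩
    (2 * 2) * (k ^ a * k ^ b) ≤⟨ *-monoˡ-≤ _ (*-mono-≤ 1<k 1<k) ⟩
    (k * k) * (k ^ a * k ^ b) ≡⟨ *-assoc k k _ ⟩
    k * (k * (k ^ a * k ^ b)) ≡⟨ cong (λ x → k * (k * x)) (^-distribˡ-+-* k a b) ⟨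
    k ^ (2 + a + b)           ∎
    where
    open ≤-Reasoning
    regroup : ∀ t x y → (t * x) * (t * y) ≡ (t * t) * (x * y)
    regroup = solve-∀

module _ (k : ℕ) .{{_ : NonZero k}} (1<k : 1 < k) (R : ℕ) (0<R : 0 < R) (m : ℕ) (X : List ℕ)
         (f : ℕ → ℕ → Fin k) (sparse : Sparse (λ x → x * k ^ x) X) (above : All (k ^ R ≤_) X) where

  private
    1≤ : ∀ {x} → x ∈ X → 1 ≤ x
    1≤ x∈ = ≤-trans (m^n>0 k R) (All.lookup above x∈)

    2≤ : ∀ {x} → x ∈ X → 2 ≤ x
    2≤ x∈ = ≤-trans (s≤s 0<R) (≤-trans (n<k^n k 1<k R) (All.lookup above x∈))

    tall : ∀ {x y} → x ∈ X → y ∈ X → x < y → 2 * k ^ R < y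
    tall {x} x∈ y∈ x<y = begin-strict
      2 * k ^ R   ≡⟨ *-comm 2 (k ^ R) ⟩
      k ^ R * 2   ≤⟨ *-mono-≤ (All.lookup above x∈) (≤-trans (s≤s (1≤ x∈)) (n<k^n k 1<k x)) ⟩
      x * k ^ x   <⟨ sparse x∈ y∈ x<y ⟩
      _           ∎
      where open ≤-Reasoning

    2+R+length≤ : ∀ {W w} → W ⊆ X → Increasing W → 2 ≤ length W → All (_≤ w) W → 2 + R + length W ≤ w
    2+R+length≤ {x₁ ∷ x₂ ∷ W} {w} W⊆X ((x₁<x₂ ∷ _) ∷ inc) _ (_ ∷ ≤w) = begin
      2 + R + (2 + length W)      ≡⟨ regroup R (length W) ⟩
      (R + 4) + length W          ≤⟨ +-monoˡ-≤ (length W) R+4≤x₂ ⟩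
      x₂ + length W               ≤⟨ increasing-spread inc ≤w ⟩
      w                           ∎
      where
      open ≤-Reasoning
      regroup : ∀ R n → 2 + R + (2 + n) ≡ (R + 4) + n
      regroup = solve-∀
      double : ∀ R → R + (R + 3) ≡ suc (2 * suc R)
      double = solve-∀
      R+4≤x₂ : R + 4 ≤ x₂
      R+4≤x₂ = begin
        R + 4             ≤⟨ +-monoʳ-≤ R (+-monoˡ-≤ 3 0<R) ⟩
        R + (R + 3)       ≡⟨ double R ⟩
        suc (2 * suc R)   ≤⟨ s≤s (*-monoʳ-≤ 2 (n<k^n k 1<k R)) ⟩
        suc (2 * k ^ R)   ≤⟨ tall (W⊆X (here refl)) (W⊆X (there (here refl))) x₁<x₂ ⟩
        x₂                ∎
    2+R+length≤ {_ ∷ []} _ _ (s≤s ()) _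

  record HomogeneousBlocks {K} (c : ℕ → Fin K) (q : ℕ) (L : List ℕ) : Set where
    field
      set         : List ℕ
      set⊆        : set ⊆ L
      increasing  : Increasing set
      blocks      : Blocks m q set
      homogeneous : ∀ {x y} → x ∈ set → y ∈ set → c x ≡ c y

  homogeneousBlocks : ∀ {K} .{{_ : NonZero K}} (c : ℕ → Fin K) q {N L} → Blocks m N L → Increasing L → L ⊆ X →
                      All (2 * K ≤_) L → q * (2 * K) ≤ N → HomogeneousBlocks c q L
  homogeneousBlocks {K} c q Ps inc L⊆X big bound with partition c m q Ps inc sparse′ big bound
    where
    sparse′ : Sparse (_* (2 * K)) _
    sparse′ {x} x∈ y∈ x<y = ≤-<-trans (*-monoʳ-≤ x (<⇒≤ (≤-<-trans (All.lookup big x∈) (n<k^n k 1<k x))))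
                                        (sparse (L⊆X x∈) (L⊆X y∈) x<y)
  ... | S , S⊆ , incS , BsS , a , mono = record
    { set = S ; set⊆ = S⊆ ; increasing = incS ; blocks = BsS
    ; homogeneous = λ x∈ y∈ → trans (All.lookup mono x∈) (sym (All.lookup mono y∈)) }

  record Thinned : Set where
    field
      elems      : List ℕ
      width      : ℕ
      blocks     : Blocks m (width * (2 * k ^ R)) elems
      increasing : Increasing elems
      elems⊆X    : elems ⊆ X
      width∈X    : width ∈ X
      width<     : All (width <_) elems
  open Thinned

  -- x ≤ width r allows a pair of earlier points ending in x to be followed by x of the ω^m-blocks
  -- kept in r (Block-after-pair).
  EndHomogeneous : List ℕ → Thinned → Set
  EndHomogeneous W r =
    ∀ {x} → x ∈ W → x ≤ width r × (∀ {y y′} → y ∈ elems r → y′ ∈ elems r → f x y ≡ f x y′)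

  EndHomogeneous-⊆ : ∀ {V W r} → V ⊆ W → EndHomogeneous W r → EndHomogeneous V r
  EndHomogeneous-⊆ V⊆W hom x∈ = hom (V⊆W x∈)

  -- The points of body are coloured by their profiles (f(x, y))_{x ∈ W}; since 2 + R + |W| ≤ w and
  -- w · kʷ < z, the block z ∷ body has enough ω^m-blocks for these k^|W| colours.
  thinBlock : ∀ W w {z body} → Blocks m z body → Increasing (W ++ z ∷ body) → (W ++ z ∷ body) ⊆ X →
              2 ≤ length W → w ∈ W → All (_≤ w) W → Σ Thinned λ r → elems r ⊆ body × EndHomogeneous W r
  thinBlock W w {z} {body} Bs inc ⊆X 2≤|W| w∈ W≤w with AllPairs-++⁻ W inc
  ... | incW , (z<body ∷ inc-body) , W≺ = r , H.set⊆ , homW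
    where
    a = length W
    w∈X = ⊆X (∈-++⁺ˡ w∈)
    w<z = W≺ w∈ (here refl)
    k^w<z : k ^ w < z
    k^w<z = ≤-<-trans (n≤m*n (k ^ w) (1≤ w∈X)) (sparse w∈X (⊆X (∈-++⁺ʳ W (here refl))) w<z)
    A*B≤k^w : (2 * k ^ R) * (2 * k ^ a) ≤ k ^ w
    A*B≤k^w = ≤-trans ([2*k^a]*[2*k^b]≤k^[2+a+b] k 1<k R a)
                      (^-monoʳ-≤ k (2+R+length≤ (⊆X ∘ ∈-++⁺ˡ) incW 2≤|W| W≤w))
    bound : w * (2 * k ^ R) * (2 * k ^ a) ≤ z
    bound = begin
      w * (2 * k ^ R) * (2 * k ^ a)   ≡⟨ *-assoc w _ _ ⟩
      w * ((2 * k ^ R) * (2 * k ^ a)) ≤⟨ *-monoʳ-≤ w A*B≤k^w ⟩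
      w * k ^ w                       <⟨ sparse w∈X (⊆X (∈-++⁺ʳ W (here refl))) w<z ⟩
      z                               ∎
      where open ≤-Reasoning
    big : All (2 * k ^ a ≤_) body
    big = All.tabulate λ y∈ →
      ≤-trans (n≤m*n _ (≤-trans (m^n>0 k R) (m≤m+n _ _)))
              (≤-trans A*B≤k^w (<⇒≤ (<-trans k^w<z (All.lookup z<body y∈))))
    H : HomogeneousBlocks (λ y → encode W (λ x → f x y)) (w * (2 * k ^ R)) body
    H = homogeneousBlocks {{m^n≢0 k a}} (λ y → encode W (λ x → f x y)) (w * (2 * k ^ R)) Bs inc-body
          (λ y∈ → ⊆X (∈-++⁺ʳ W (there y∈))) big bound
    module H = HomogeneousBlocks H
    r : Thinned
    r = record { elems = H.set ; width = w ; blocks = H.blocks ; increasing = H.increasing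
               ; elems⊆X = λ y∈ → ⊆X (∈-++⁺ʳ W (there (H.set⊆ y∈))) ; width∈X = w∈X
               ; width< = All.tabulate λ y∈ → <-trans w<z (All.lookup z<body (H.set⊆ y∈)) }
    homW : EndHomogeneous W r
    homW x∈ = All.lookup W≤w x∈ , λ y∈ y′∈ → encode-injective W (H.homogeneous y∈ y′∈) x∈

  thin : ∀ {j P} W w → Blocks (suc m) j P → Increasing (W ++ P) → (W ++ P) ⊆ X →
         2 ≤ length W → w ∈ W → All (_≤ w) W →
         Σ (List Thinned) λ rs → length rs ≡ j ×
           AllPairs (λ r r′ → EndHomogeneous (elems r) r′) rs × All (EndHomogeneous W) rs
  thin W w [] _ _ _ _ _ = [] , refl , [] , []
  thin W w (_∷_ {P = P} (node {x = z} {P = body} Bs) Ps) inc ⊆X 2≤|W| w∈ W≤w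
    with thinBlock W w Bs (prefix-increasing refl inc′) (λ y∈ → ⊆X′ (∈-++⁺ˡ y∈)) 2≤|W| w∈ W≤w
       | thin (W ++ z ∷ body) (max z body) Ps inc′ ⊆X′ 2≤|W′| w′∈W′ W′≤w′
    where
    inc′ : Increasing ((W ++ z ∷ body) ++ P)
    inc′ = subst Increasing (sym (++-assoc W (z ∷ body) P)) inc
    ⊆X′ : ((W ++ z ∷ body) ++ P) ⊆ X
    ⊆X′ = subst (_⊆ X) (sym (++-assoc W (z ∷ body) P)) ⊆X
    2≤|W′| : 2 ≤ length (W ++ z ∷ body)
    2≤|W′| = ≤-trans 2≤|W| (subst (length W ≤_) (sym (length-++ W)) (m≤m+n _ _))
    w′∈W′ : max z body ∈ W ++ z ∷ body
    w′∈W′ = ∈-++⁺ʳ W (max-∈ z body)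
    W′≤w′ : All (_≤ max z body) (W ++ z ∷ body)
    W′≤w′ = All.++⁺ (All.map (λ x≤w → ≤-trans x≤w (<⇒≤ (<-≤-trans w<z (⊥≤max z body)))) W≤w)
                    (⊥≤max z body ∷ xs≤max z body)
      where w<z = proj₂ (proj₂ (AllPairs-++⁻ W inc)) w∈ (here refl)
  ... | r , U⊆body , homW | rs , len , prec , homs =
    r ∷ rs , cong suc len ,
    All.map (λ {r′} → EndHomogeneous-⊆ {r = r′} (∈-++⁺ʳ W ∘ there ∘ U⊆body)) homs ∷ prec ,
    homW ∷ All.map (λ {r′} → EndHomogeneous-⊆ {r = r′} ∈-++⁺ˡ) homs

  -- The second thinning, by the profiles (f(x, h))ₕ over the least points h of the thinned blocks.
  module Cores (rs : List Thinned) (|rs|<R : length rs < R) where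

    Hs : List ℕ
    Hs = map (hd ∘ elems) rs

    instance
      K-nonZero : NonZero (k ^ length Hs)
      K-nonZero = m^n≢0 k (length Hs)

    colour : ℕ → Fin (k ^ length Hs)
    colour x = encode Hs (f x)

    K≤k^R : k ^ length Hs ≤ k ^ R
    K≤k^R = ^-monoʳ-≤ k (≤-trans (≤-reflexive (length-map _ rs)) (<⇒≤ |rs|<R))

    coreOf : (r : Thinned) → HomogeneousBlocks colour (width r) (elems r)
    coreOf r = homogeneousBlocks colour (width r) (blocks r) (increasing r) (elems⊆X r)
      (All.tabulate λ y∈ → ≤-trans (*-monoʳ-≤ 2 K≤k^R)
                                   (<⇒≤ (tall (width∈X r) (elems⊆X r y∈) (All.lookup (width< r) y∈))))
      (*-monoʳ-≤ (width r) (*-monoʳ-≤ 2 K≤k^R))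

    core : Thinned → List ℕ
    core r = HomogeneousBlocks.set (coreOf r)

    goodPair : ∀ {B r} → r ∈ rs → B ⊆ X → Increasing B → 2 ≤ length B →
               (∀ {x x′} → x ∈ B → x′ ∈ B → colour x ≡ colour x′) → EndHomogeneous B r →
               GoodPair f (suc m) X B (core r)
    goodPair {_ ∷ []} _ _ _ (s≤s ()) _ _
    goodPair {b₁ ∷ b₂ ∷ B} {r} r∈ B⊆X incB _ homB endB =
      let Y , incY , largeY , Y⊆ = Block-after-pair incB C.blocks C.increasing (proj₁ (endB (there (here refl)))) B≺C
      in  B≺C , constant , Y , incY , ⊆X Y⊆ , largeY , Y⊆
      where
      module C = HomogeneousBlocks (coreOf r)
      B≺C : (b₁ ∷ b₂ ∷ B) ≺ C.set
      B≺C x∈ y∈ = ≤-<-trans (proj₁ (endB x∈)) (All.lookup (width< r) (C.set⊆ y∈))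
      constant : ∀ {x y} → x ∈ b₁ ∷ b₂ ∷ B → y ∈ C.set → f x y ≡ f b₁ (hd C.set)
      constant {x} {y} x∈ y∈ = begin
        f x y               ≡⟨ proj₂ (endB x∈) (C.set⊆ y∈) u∈ ⟩
        f x u               ≡⟨ encode-injective Hs (homB x∈ (here refl)) (∈-map⁺ (hd ∘ elems) r∈) ⟩
        f b₁ u              ≡⟨ proj₂ (endB (here refl)) (C.set⊆ (∈⇒hd-∈ y∈)) u∈ ⟨
        f b₁ (hd C.set)     ∎
        where
        open ≡-Reasoning
        u = hd (elems r)
        u∈ = ∈⇒hd-∈ (C.set⊆ y∈)
      ⊆X : ∀ {Y} → Y ⊆ ((b₁ ∷ b₂ ∷ B) ++ C.set) → Y ⊆ X
      ⊆X Y⊆ y∈ with ∈-++⁻ (b₁ ∷ b₂ ∷ B) (Y⊆ y∈)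
      ... | inj₁ y∈B = B⊆X y∈B
      ... | inj₂ y∈C = elems⊆X r (C.set⊆ y∈C)

    goodCores : AllPairs (λ r r′ → EndHomogeneous (elems r) r′) rs → AllPairs (GoodPair f (suc m) X) (map core rs)
    goodCores = AllPairs.map⁺ ∘ AllPairs-mapWithAll goodCore (All.tabulate {xs = rs} (λ r∈ → r∈))
      where
      goodCore : ∀ {r r′} → r ∈ rs → r′ ∈ rs → EndHomogeneous (elems r) r′ →
                 GoodPair f (suc m) X (core r) (core r′)
      goodCore {r} {r′} _ r′∈ end = goodPair r′∈ (λ x∈ → elems⊆X r (C.set⊆ x∈)) C.increasing
        (≤-trans (2≤ (width∈X r)) (Blocks-length C.blocks)) C.homogeneous (EndHomogeneous-⊆ {r = r′} C.set⊆ end)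
        where module C = HomogeneousBlocks (coreOf r)

  sparseBlocks⇒HomogeneousFamily : ∀ {d P} → Blocks (suc m) R P → Increasing P → P ⊆ X →
                                   RamseyProp k (2 * d) R → HomogeneousFamily f (suc m) X d
  sparseBlocks⇒HomogeneousFamily (node {x = z₀} {P = body₀} Bs₀ ∷ Ps) incP P⊆X ramsey
    with thin (z₀ ∷ body₀) (max z₀ body₀) Ps incP P⊆X
              (s≤s (≤-trans (1≤ (P⊆X (here refl))) (Blocks-length Bs₀)))
              (max-∈ z₀ body₀) (⊥≤max z₀ body₀ ∷ xs≤max z₀ body₀)
  ... | rs , |rs|≡ , prec , homU₀ =
    GoodPairs⇒HomogeneousFamily f (suc m) X (F ∷ map core rs) (cong suc (trans (length-map core rs) |rs|≡))
      (All.map⁺ (All.tabulate λ {r} r∈ →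
                   goodPair r∈ F⊆X incF 2≤|F| homF (EndHomogeneous-⊆ {r = r} F⊆U₀ (All.lookup homU₀ r∈)))
       ∷ goodCores prec)
      ramsey
    where
    open Cores rs (s≤s (≤-reflexive |rs|≡))
    -- The first block only ever stands on the left of a pair, so two of its points with the
    -- same profile suffice.
    U₀ = z₀ ∷ body₀
    a = proj₁ (pigeonhole colour U₀)
    P? = λ x → colour x Fin.≟ a

    F : List ℕ
    F = ofColour colour a U₀

    F⊆U₀ : F ⊆ U₀
    F⊆U₀ x∈ = proj₁ (∈-filter⁻ P? {xs = U₀} x∈)

    F⊆X : F ⊆ X
    F⊆X x∈ = P⊆X (∈-++⁺ˡ (F⊆U₀ x∈))

    incF : Increasing F
    incF = AllPairs.filter⁺ P? {xs = U₀} (proj₁ (AllPairs-++⁻ U₀ incP))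

    2≤|F| : 2 ≤ length F
    2≤|F| = m<n≤m*o⇒2≤o
      (s≤s (≤-trans K≤k^R (≤-trans (All.lookup above (P⊆X (here refl))) (Blocks-length Bs₀))))
      (proj₂ (pigeonhole colour U₀))

    homF : ∀ {x x′} → x ∈ F → x′ ∈ F → colour x ≡ colour x′
    homF x∈ x′∈ = trans (proj₂ (∈-filter⁻ P? {xs = U₀} x∈)) (sym (proj₂ (∈-filter⁻ P? {xs = U₀} x′∈)))

Fin1-unique : (i j : Fin 1) → i ≡ j
Fin1-unique zero zero = refl

RamseyProp⇒0< : ∀ {k d R} → (ℕ → ℕ → Fin k) → RamseyProp k (suc d) R → 0 < R
RamseyProp⇒0< f ramsey with ramsey f
... | _ ∷ _ , _ , _ , h<R ∷ _ , _ = ≤-trans (s≤s z≤n) h<R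

Blocks⇒HomogeneousFamily : ∀ k .{{_ : NonZero k}} n {d R P X} (f : ℕ → ℕ → Fin k) → 0 < R →
  Blocks n R P → Increasing P → P ⊆ X → Sparse (λ x → x * k ^ x) X → All (k ^ R ≤_) X →
  RamseyProp k (2 * d) R → HomogeneousFamily f n X d
Blocks⇒HomogeneousFamily k zero f _ Ps incP P⊆X _ _ =
  blockwiseConstant⇒HomogeneousFamily f 0 _ Ps P⊆X incP λ { (leaf _) (leaf _) (here refl) (here refl) → refl }
Blocks⇒HomogeneousFamily 1 (suc m) f _ Ps incP P⊆X _ _ =
  blockwiseConstant⇒HomogeneousFamily f (suc m) _ Ps P⊆X incP λ _ _ _ _ → Fin1-unique _ _
Blocks⇒HomogeneousFamily k@(suc (suc _)) (suc m) {R = R} {X = X} f 0<R Ps incP P⊆X sparse above =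
  sparseBlocks⇒HomogeneousFamily k (s≤s (s≤s z≤n)) R 0<R m X f sparse above Ps incP P⊆X

mainTheorem11 : (k n d : ℕ) → .{{_ : NonZero k}} → (R : ℕ) → IsRamseyNumber k (2 * d) R →
    (X : List ℕ) → IncList X → Large ((ωpow· n) R) X → Sparse (λ x → x * k ^ x) X →
    All (λ x → k ^ R ≤ x) X →
    (f : ℕ → ℕ → Fin k) →
    Σ (Fin d → List ℕ) λ Y → Σ (Fin k) λ c →
    (∀ s → IncList (Y s) × Y s ⊆ X × Large (ωpow+1 n) (Y s)) ×
    (∀ s t → s <ᶠ t → (Y s ≺ Y t) × (∀ {x y} → x ∈ Y s → y ∈ Y t → f x y ≡ c))
mainTheorem11 k n zero    R _            X _     _     _      _     f = (λ ()) , f 0 0 , (λ ()) , λ ()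
mainTheorem11 k n (suc d) R (ramsey , _) X incX large sparse above f with Blocks-prefix n R 𝟎 X large
... | P , Q , refl , Ps , _ =
  Blocks⇒HomogeneousFamily k n f (RamseyProp⇒0< f ramsey) Ps (proj₁ (AllPairs-++⁻ P (Linked⇒AllPairs <-trans incX)))
    ∈-++⁺ˡ sparse above ramsey
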